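{- Let $X=MD(G,S_0,S_1,T_0,T_1)$ be a strongly connected mixed Cayley digraph and let $A$ be a $\lambda$-atom of $X$. If $\lambda(X)<\delta(X)$, then $|A\cap X_i|\geq 2$ for $i=0,1$, where $X_i=\{(g,i): g\in G\}$.
   Context: $G$ is a finite group with identity $1_G$, $S_0,S_1\subseteq G\setminus\{1_G\}$, $T_0,T_1\subseteq G$. The mixed Cayley digraph $X=MD(G,S_0,S_1,T_0,T_1)$ has vertex set $G\times\{0,1\}$ and arcs $((g,i),(sg,i))$ for $g\in G$, $s\in S_i$, $i=0,1$; $((g,0),(tg,1))$ for $g\in G$, $t\in T_0$; and $((tg,1),(g,0))$ for $g\in G$, $t\in T_1$. $\delta(X)$ is the minimum over all vertices of all in-degrees and out-degrees; $\lambda(X)$ is the arc-connectivity (minimum number of arcs whose removal leaves a non-strongly-connected digraph). For $A\subseteq V(X)$, $\omega^+(A)$ (resp. $\omega^-(A)$) is the set of arcs from $A$ to $V(X)\setminus A$ (resp. from $V(X)\setminus A$ to $A$). A proper nonempty $A\subseteq V(X)$ is a positive (resp. negative) arc fragment if $|\omega^+(A)|=\lambda(X)$ (resp. $|\omega^-(A)|=\lambda(X)$); an arc fragment is either of these. A $\lambda$-atom is an arc fragment of least possible cardinality. -}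

module Defs where

open import Data.Nat using (ℕ; zero; suc; _+_; _≤_)
open import Data.Fin using (Fin; zero; suc)
open import Data.Fin.Subset using (Subset)
open import Data.Vec using (lookup)
open import Data.Bool using (Bool; true; false; _∧_; not; if_then_else_)
open import Data.Product using (_×_; _,_; ∃; ∃-syntax)
open import Data.Sum using (_⊎_)
open import Relation.Binary.PropositionalEquality using (_≡_)
open import Relation.Nullary using (¬_)
open import Algebra.Structures using (IsGroup)

-- A finite group, presented (up to isomorphism) on the carrier Fin n.
record FinGroup : Set where
  field
    n       : ℕ
    _∙_     : Fin n → Fin n → Fin n
    ε       : Fin n
    _⁻¹     : Fin n → Fin n
    isGroup : IsGroup _≡_ _∙_ ε _⁻¹

sumFin : ∀ k → (Fin k → ℕ) → ℕ
sumFin zero    f = 0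
sumFin (suc k) f = f zero + sumFin k (λ x → f (suc x))

[_] : Bool → ℕ
[ b ] = if b then 1 else 0

module MixedCayley (G : FinGroup) (S₀ S₁ T₀ T₁ : Subset (FinGroup.n G)) where
  open FinGroup G

  Vtx : Set
  Vtx = Fin n × Fin 2

  VSet : Set
  VSet = Vtx → Bool

  ASet : Set
  ASet = Vtx → Vtx → Bool

  -- arcs of MD(G,S₀,S₁,T₀,T₁):
  --   (g,i) → (s g, i), s ∈ Sᵢ        i.e. (g,i) → (h,i) iff h g⁻¹ ∈ Sᵢ
  --   (g,0) → (t g, 1), t ∈ T₀        i.e. (g,0) → (h,1) iff h g⁻¹ ∈ T₀
  --   (t g,1) → (g, 0), t ∈ T₁        i.e. (x,1) → (h,0) iff x h⁻¹ ∈ T₁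
  arc : ASet
  arc (g , zero)          (h , zero)          = lookup S₀ (h ∙ (g ⁻¹))
  arc (g , suc zero)      (h , suc zero)      = lookup S₁ (h ∙ (g ⁻¹))
  arc (g , zero)          (h , suc zero)      = lookup T₀ (h ∙ (g ⁻¹))
  arc (x , suc zero)      (h , zero)          = lookup T₁ (x ∙ (h ⁻¹))

  sumV : (Vtx → ℕ) → ℕ
  sumV f = sumFin n (λ g → sumFin 2 (λ i → f (g , i)))

  ∣_∣ᵥ : VSet → ℕ
  ∣ A ∣ᵥ = sumV (λ v → [ A v ])

  ∣_∣ₐ : ASet → ℕ
  ∣ F ∣ₐ = sumV (λ u → sumV (λ v → [ F u v ]))

  outdeg indeg : Vtx → ℕ
  outdeg u = sumV (λ v → [ arc u v ])
  indeg  v = sumV (λ u → [ arc u v ])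

  IsMinDegree : ℕ → Set
  IsMinDegree d = (∀ v → d ≤ outdeg v × d ≤ indeg v)
                × (∃[ v ] (outdeg v ≡ d ⊎ indeg v ≡ d))

  data Reach (R : ASet) : Vtx → Vtx → Set where
    here : ∀ {u} → Reach R u u
    step : ∀ {u w v} → R u w ≡ true → Reach R w v → Reach R u v

  StronglyConnected : ASet → Set
  StronglyConnected R = ∀ u v → Reach R u v

  _⊆arcs : ASet → Set
  F ⊆arcs = ∀ u v → F u v ≡ true → arc u v ≡ true

  remove : ASet → ASet
  remove F u v = arc u v ∧ not (F u v)

  IsArcConnectivity : ℕ → Set
  IsArcConnectivity l =
      (∃[ F ] (F ⊆arcs × ∣ F ∣ₐ ≡ l × ¬ StronglyConnected (remove F)))
    × (∀ F → F ⊆arcs → ¬ StronglyConnected (remove F) → l ≤ ∣ F ∣ₐ)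

  ProperNonempty : VSet → Set
  ProperNonempty A = (∃[ v ] A v ≡ true) × (∃[ v ] A v ≡ false)

  ω⁺ ω⁻ : VSet → ASet
  ω⁺ A u v = A u ∧ not (A v) ∧ arc u v
  ω⁻ A u v = not (A u) ∧ A v ∧ arc u v

  IsArcFragment : ℕ → VSet → Set
  IsArcFragment l A = ProperNonempty A × (∣ ω⁺ A ∣ₐ ≡ l ⊎ ∣ ω⁻ A ∣ₐ ≡ l)

  IsλAtom : ℕ → VSet → Set
  IsλAtom l A = IsArcFragment l A × (∀ B → IsArcFragment l B → ∣ A ∣ᵥ ≤ ∣ B ∣ᵥ)

  ∣_∩X_∣ : VSet → Fin 2 → ℕ
  ∣ A ∩X i ∣ = sumFin n (λ g → [ A (g , i) ])

-- If |A| ≤ δ then every vertex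
-- of A has at least δ + 1 − |A| out-neighbours outside A, so |ω⁺(A)| ≥ |A|(δ + 1 − |A|) ≥ δ;
-- hence |A| > δ.  The mixed Cayley digraph is block-regular: between layers X_i and X_j every
-- vertex has the same number c i j of out- resp. in-neighbours.  If A meets X_i in p ≤ 1
-- vertices and X_j in k vertices, then ω⁺(A) contains the p·c i i arcs leaving the vertex of
-- A ∩ X_i inside X_i and at least (k − p)·c j i arcs from A ∩ X_j to X_i − A.  Since c j i ≥ 1
-- (strong connectivity), k ≥ δ ≥ 2 (as λ ≥ 1) and c i i + c j i is an in-degree, this is ≥ δ.
-- Negative fragments are positive fragments of the reversed digraph, which is block-regular
-- with the transposed matrix.

module Submission where

open import Defs
open import Data.Nat using (ℕ; zero; suc; _+_; _*_; _∸_; _≤_; _<_; z≤n; s≤s; s≤s⁻¹; _≤?_)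
open import Data.Nat.Properties hiding (_≟_)
open import Data.Fin using (Fin; zero; suc; opposite; _≟_)
open import Data.Fin.Properties using (opposite-involutive)
open import Data.Fin.Subset using (Subset; _∉_)
open import Data.Fin.Permutation using (permutation)
open import Data.Vec using (lookup)
open import Data.Vec.Properties using (lookup⇒[]=)
open import Data.Bool using (Bool; true; false; _∧_; not)
open import Data.Bool.Properties using (∧-comm; ∧-assoc; ¬-not)
open import Data.Product using (_×_; _,_; proj₁; proj₂; ∃₂; swap)
open import Data.Sum using (_⊎_; inj₁; inj₂)
open import Function using (_∘_; flip)
open import Relation.Nullary using (yes; no; contradiction)
open import Relation.Binary.PropositionalEquality hiding ([_])
open import Algebra.Bundles using (Group)
open import Algebra.Structures using (IsGroup)
import Algebra.Properties.Group as GroupProperties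
open import Algebra.Properties.CommutativeMonoid.Sum +-0-commutativeMonoid
  using (sum; ∑-distrib-+; ∑-comm; sum-permute)
open import Algebra.Properties.Semiring.Sum +-*-semiring using (*-distribʳ-sum)

sumFin≡sum : ∀ k (f : Fin k → ℕ) → sumFin k f ≡ sum f
sumFin≡sum zero    f = refl
sumFin≡sum (suc k) f = cong (f zero +_) (sumFin≡sum k (f ∘ suc))

sumFin-cong : ∀ k {f g : Fin k → ℕ} → (∀ x → f x ≡ g x) → sumFin k f ≡ sumFin k g
sumFin-cong zero    f≗g = refl
sumFin-cong (suc k) f≗g = cong₂ _+_ (f≗g zero) (sumFin-cong k (f≗g ∘ suc))

sumFin-mono : ∀ k {f g : Fin k → ℕ} → (∀ x → f x ≤ g x) → sumFin k f ≤ sumFin k g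
sumFin-mono zero    f≤g = z≤n
sumFin-mono (suc k) f≤g = +-mono-≤ (f≤g zero) (sumFin-mono k (f≤g ∘ suc))

sumFin-zero : ∀ k → sumFin k (λ _ → 0) ≡ 0
sumFin-zero zero    = refl
sumFin-zero (suc k) = sumFin-zero k

f≤sumFin : ∀ k (f : Fin k → ℕ) x → f x ≤ sumFin k f
f≤sumFin (suc k) f zero    = m≤m+n _ _
f≤sumFin (suc k) f (suc x) = ≤-trans (f≤sumFin k (f ∘ suc) x) (m≤n+m _ _)

f+f≤sumFin : ∀ k (f : Fin k → ℕ) {x y} → x ≢ y → f x + f y ≤ sumFin k f
f+f≤sumFin (suc k) f {zero}  {zero}  x≢y = contradiction refl x≢y
f+f≤sumFin (suc k) f {zero}  {suc y} _   = +-monoʳ-≤ (f zero) (f≤sumFin k (f ∘ suc) y)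
f+f≤sumFin (suc k) f {suc x} {zero}  _   =
  ≤-trans (≤-reflexive (+-comm (f (suc x)) (f zero))) (+-monoʳ-≤ (f zero) (f≤sumFin k (f ∘ suc) x))
f+f≤sumFin (suc k) f {suc x} {suc y} x≢y =
  ≤-trans (f+f≤sumFin k (f ∘ suc) (x≢y ∘ cong suc)) (m≤n+m _ _)

sumFin-+ : ∀ k (f g : Fin k → ℕ) → sumFin k (λ x → f x + g x) ≡ sumFin k f + sumFin k g
sumFin-+ k f g = begin
  sumFin k (λ x → f x + g x) ≡⟨ sumFin≡sum k _ ⟩
  sum (λ x → f x + g x)      ≡⟨ ∑-distrib-+ f g ⟩
  sum f + sum g              ≡⟨ sym (cong₂ _+_ (sumFin≡sum k f) (sumFin≡sum k g)) ⟩
  sumFin k f + sumFin k g    ∎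
  where open ≡-Reasoning

sumFin-*ʳ : ∀ k c (f : Fin k → ℕ) → sumFin k (λ x → f x * c) ≡ sumFin k f * c
sumFin-*ʳ k c f = begin
  sumFin k (λ x → f x * c) ≡⟨ sumFin≡sum k _ ⟩
  sum (λ x → f x * c)      ≡⟨ sym (*-distribʳ-sum c f) ⟩
  sum f * c                ≡⟨ sym (cong (_* c) (sumFin≡sum k f)) ⟩
  sumFin k f * c           ∎
  where open ≡-Reasoning

sumFin-comm : ∀ a b (f : Fin a → Fin b → ℕ) →
  sumFin a (λ x → sumFin b (f x)) ≡ sumFin b (λ y → sumFin a (λ x → f x y))
sumFin-comm a b f = begin
  sumFin a (λ x → sumFin b (f x))          ≡⟨ sumFin-cong a (λ x → sumFin≡sum b (f x)) ⟩
  sumFin a (λ x → sum (f x))               ≡⟨ sumFin≡sum a _ ⟩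
  sum (λ x → sum (f x))                    ≡⟨ ∑-comm f ⟩
  sum (λ y → sum (λ x → f x y))            ≡⟨ sym (sumFin≡sum b _) ⟩
  sumFin b (λ y → sum (λ x → f x y))       ≡⟨ sym (sumFin-cong b (λ y → sumFin≡sum a _)) ⟩
  sumFin b (λ y → sumFin a (λ x → f x y))  ∎
  where open ≡-Reasoning

sumFin-reindex : ∀ k (f : Fin k → ℕ) (π σ : Fin k → Fin k) →
  (∀ y → π (σ y) ≡ y) → (∀ x → σ (π x) ≡ x) → sumFin k (f ∘ π) ≡ sumFin k f
sumFin-reindex k f π σ πσ σπ = begin
  sumFin k (f ∘ π) ≡⟨ sumFin≡sum k _ ⟩
  sum (f ∘ π)      ≡⟨ sym (sum-permute f (permutation π σ πσ σπ)) ⟩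
  sum f            ≡⟨ sym (sumFin≡sum k f) ⟩
  sumFin k f       ∎
  where open ≡-Reasoning

[]*≤ : ∀ b m → [ b ] * m ≤ m
[]*≤ true  m = ≤-reflexive (+-identityʳ m)
[]*≤ false m = z≤n

[]-split : ∀ a b → [ b ] ≡ [ a ∧ b ] + [ not a ∧ b ]
[]-split true  b = sym (+-identityʳ [ b ])
[]-split false b = refl

sumFin-[∧]ˡ : ∀ k a (f : Fin k → Bool) → sumFin k (λ x → [ a ∧ f x ]) ≡ [ a ] * sumFin k (λ x → [ f x ])
sumFin-[∧]ˡ k true  f = sym (*-identityˡ _)
sumFin-[∧]ˡ k false f = sumFin-zero k

size : ∀ {k} → (Fin k → Bool) → ℕ
size {k} P = sumFin k (λ x → [ P x ])

size≤1⇒unique : ∀ {k} (P : Fin k → Bool) {x y} → size P ≤ 1 → P x ≡ true → P y ≡ true → x ≡ y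
size≤1⇒unique {k} P {x} {y} P≤1 Px Py with x ≟ y
... | yes x≡y = x≡y
... | no  x≢y = contradiction (≤-trans 2≤size P≤1) 1+n≰n
  where
  2≤size : 2 ≤ size P
  2≤size = subst₂ (λ a b → [ a ] + [ b ] ≤ size P) Px Py (f+f≤sumFin k (λ z → [ P z ]) x≢y)

crossing-count : ∀ {k t} (P Q : Fin k → Bool) (E : Fin k → Fin k → Bool) →
  (∀ u → size (E u) ≡ t) → (∀ v → size (λ u → E u v) ≡ t) →
  size Q * t ≤ sumFin k (λ u → sumFin k (λ v → [ Q u ∧ not (P v) ∧ E u v ])) + size P * t
crossing-count {k} {t} P Q E rows columns = begin
  size Q * t
    ≡⟨ sym (sumFin-*ʳ k t _) ⟩
  sumFin k (λ u → [ Q u ] * t)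
    ≡⟨ sumFin-cong k per-row ⟩
  sumFin k (λ u → [ Q u ] * exits u + [ Q u ] * entries u)
    ≡⟨ sumFin-+ k _ _ ⟩
  sumFin k (λ u → [ Q u ] * exits u) + sumFin k (λ u → [ Q u ] * entries u)
    ≤⟨ +-mono-≤ (≤-reflexive (sym (sumFin-cong k λ u → sumFin-[∧]ˡ k (Q u) _)))
                (sumFin-mono k λ u → []*≤ (Q u) (entries u)) ⟩
  leaving + sumFin k entries
    ≡⟨ cong (leaving +_) entries-total ⟩
  leaving + size P * t ∎
  where
  open ≤-Reasoning
  leaving : ℕ
  leaving = sumFin k (λ u → sumFin k (λ v → [ Q u ∧ not (P v) ∧ E u v ]))
  exits entries : Fin k → ℕ
  exits   u = sumFin k (λ v → [ not (P v) ∧ E u v ])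
  entries u = sumFin k (λ v → [ P v ∧ E u v ])
  per-row : ∀ u → [ Q u ] * t ≡ [ Q u ] * exits u + [ Q u ] * entries u
  per-row u = begin-equality
    [ Q u ] * t                           ≡⟨ cong ([ Q u ] *_) (sym (rows u)) ⟩
    [ Q u ] * size (E u)                  ≡⟨ cong ([ Q u ] *_) (sumFin-cong k λ v → []-split (P v) (E u v)) ⟩
    [ Q u ] * sumFin k (λ v → [ P v ∧ E u v ] + [ not (P v) ∧ E u v ])
                                          ≡⟨ cong ([ Q u ] *_) (trans (sumFin-+ k _ _) (+-comm (entries u) (exits u))) ⟩
    [ Q u ] * (exits u + entries u)       ≡⟨ *-distribˡ-+ [ Q u ] (exits u) (entries u) ⟩
    [ Q u ] * exits u + [ Q u ] * entries u ∎
  entries-total : sumFin k entries ≡ size P * t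
  entries-total = begin-equality
    sumFin k entries                                    ≡⟨ sumFin-comm k k _ ⟩
    sumFin k (λ v → sumFin k (λ u → [ P v ∧ E u v ]))   ≡⟨ sumFin-cong k (λ v → sumFin-[∧]ˡ k (P v) _) ⟩
    sumFin k (λ v → [ P v ] * size (λ u → E u v))       ≡⟨ sumFin-cong k (λ v → cong ([ P v ] *_) (columns v)) ⟩
    sumFin k (λ v → [ P v ] * t)                        ≡⟨ sumFin-*ʳ k t _ ⟩
    size P * t                                          ∎

singleton-exits : ∀ {k s} (P : Fin k → Bool) (F : Fin k → Fin k → Bool) →
  size P ≤ 1 → (∀ a → F a a ≡ false) → (∀ a → size (F a) ≡ s) →
  sumFin k (λ a → sumFin k (λ x → [ P a ∧ not (P x) ∧ F a x ])) ≡ size P * s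
singleton-exits {k} {s} P F P≤1 loopless rows =
  trans (sumFin-cong k exits) (sumFin-*ʳ k s _)
  where
  exits : ∀ a → sumFin k (λ x → [ P a ∧ not (P x) ∧ F a x ]) ≡ [ P a ] * s
  exits a with P a in Pa
  ... | false = sumFin-zero k
  ... | true  = trans (sumFin-cong k stays-outside) (trans (rows a) (sym (*-identityˡ s)))
    where
    stays-outside : ∀ x → [ not (P x) ∧ F a x ] ≡ [ F a x ]
    stays-outside x with P x in Px
    ... | false = refl
    ... | true  = sym (cong [_] (trans (cong (F a) (size≤1⇒unique P P≤1 Px Pa)) (loopless a)))

n≤m*[1+n∸m] : ∀ {m n} → 1 ≤ m → m ≤ n → n ≤ m * (suc n ∸ m)
n≤m*[1+n∸m] {m@(suc _)} _ m≤n with m≤n⇒∃[o]m+o≡n m≤n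
... | r , refl = begin
  m + r                  ≤⟨ +-monoʳ-≤ m (m≤n*m r m) ⟩
  m + m * r              ≡⟨ sym (*-suc m r) ⟩
  m * suc r              ≡⟨ cong (m *_) (sym (m+n∸m≡n m (suc r))) ⟩
  m * (m + suc r ∸ m)    ≡⟨ cong (λ z → m * (z ∸ m)) (+-suc m r) ⟩
  m * (suc (m + r) ∸ m)  ∎
  where open ≤-Reasoning

thin-layer-arithmetic : ∀ {p k s t d ω} → p ≤ 1 → d < p + k → 2 ≤ d → 1 ≤ t → d ≤ s + t →
  p * s + k * t ≤ ω + p * t → d ≤ ω
thin-layer-arithmetic {k = k} {t = t} {ω = ω} z≤n d<k _ 1≤t _ counted = begin
  _        ≤⟨ <⇒≤ d<k ⟩
  k        ≡⟨ sym (*-identityʳ k) ⟩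
  k * 1    ≤⟨ *-monoʳ-≤ k 1≤t ⟩
  k * t    ≤⟨ counted ⟩
  ω + 0    ≡⟨ +-identityʳ ω ⟩
  ω        ∎
  where open ≤-Reasoning
thin-layer-arithmetic {k = k} {s} {t} {ω = ω} (s≤s z≤n) d<1+k 2≤d _ d≤s+t counted =
  ≤-trans d≤s+t (+-cancelʳ-≤ t (s + t) ω (begin
    s + t + t      ≡⟨ +-assoc s t t ⟩
    s + (t + t)    ≡⟨ cong (λ z → s + (t + z)) (sym (+-identityʳ t)) ⟩
    s + 2 * t      ≤⟨ +-monoʳ-≤ s (*-monoˡ-≤ t (≤-trans 2≤d (s≤s⁻¹ d<1+k))) ⟩
    s + k * t      ≡⟨ cong (_+ k * t) (sym (*-identityˡ s)) ⟩
    1 * s + k * t  ≤⟨ counted ⟩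
    ω + 1 * t      ≡⟨ cong (ω +_) (*-identityˡ t) ⟩
    ω + t          ∎))
  where open ≤-Reasoning

-- The sums below are shaped exactly like sumV, ∣_∣ᵥ and ∣_∣ₐ of Defs, so that count A,
-- arcsOut arc A and arcsIn arc A are definitionally ∣ A ∣ᵥ, ∣ ω⁺ A ∣ₐ and ∣ ω⁻ A ∣ₐ.
module TwoLayer (n : ℕ) where

  Vertex : Set
  Vertex = Fin n × Fin 2

  Digraph : Set
  Digraph = Vertex → Vertex → Bool

  ∑ᵥ : (Vertex → ℕ) → ℕ
  ∑ᵥ f = sumFin n (λ g → sumFin 2 (λ i → f (g , i)))

  layerSum : (Vertex → ℕ) → Fin 2 → ℕ
  layerSum f i = sumFin n (λ g → f (g , i))

  count : (Vertex → Bool) → ℕ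
  count A = ∑ᵥ (λ v → [ A v ])

  layerCount : (Vertex → Bool) → Fin 2 → ℕ
  layerCount A i = size (λ g → A (g , i))

  outdegree indegree : Digraph → Vertex → ℕ
  outdegree R u = ∑ᵥ (λ v → [ R u v ])
  indegree  R v = ∑ᵥ (λ u → [ R u v ])

  arcsOut arcsIn : Digraph → (Vertex → Bool) → ℕ
  arcsOut R A = ∑ᵥ (λ u → ∑ᵥ (λ v → [ A u ∧ not (A v) ∧ R u v ]))
  arcsIn  R A = ∑ᵥ (λ u → ∑ᵥ (λ v → [ not (A u) ∧ A v ∧ R u v ]))

  ∑ᵥ-cong : ∀ {f g : Vertex → ℕ} → (∀ v → f v ≡ g v) → ∑ᵥ f ≡ ∑ᵥ g
  ∑ᵥ-cong f≗g = sumFin-cong n (λ g → sumFin-cong 2 (λ i → f≗g (g , i)))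

  ∑ᵥ-mono : ∀ {f g : Vertex → ℕ} → (∀ v → f v ≤ g v) → ∑ᵥ f ≤ ∑ᵥ g
  ∑ᵥ-mono f≤g = sumFin-mono n (λ g → sumFin-mono 2 (λ i → f≤g (g , i)))

  ∑ᵥ-+ : ∀ (f g : Vertex → ℕ) → ∑ᵥ (λ v → f v + g v) ≡ ∑ᵥ f + ∑ᵥ g
  ∑ᵥ-+ f g = trans (sumFin-cong n (λ x → sumFin-+ 2 (λ i → f (x , i)) (λ i → g (x , i))))
                   (sumFin-+ n (λ x → sumFin 2 (λ i → f (x , i))) (λ x → sumFin 2 (λ i → g (x , i))))

  ∑ᵥ-*ʳ : ∀ c (f : Vertex → ℕ) → ∑ᵥ (λ v → f v * c) ≡ ∑ᵥ f * c
  ∑ᵥ-*ʳ c f = trans (sumFin-cong n (λ x → sumFin-*ʳ 2 c (λ i → f (x , i))))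
                    (sumFin-*ʳ n c (λ x → sumFin 2 (λ i → f (x , i))))

  ∑ᵥ-[∧]ˡ : ∀ a (f : Vertex → Bool) → ∑ᵥ (λ v → [ a ∧ f v ]) ≡ [ a ] * ∑ᵥ (λ v → [ f v ])
  ∑ᵥ-[∧]ˡ true  f = sym (*-identityˡ _)
  ∑ᵥ-[∧]ˡ false f = sumFin-zero n

  f≤∑ᵥ : ∀ (f : Vertex → ℕ) v → f v ≤ ∑ᵥ f
  f≤∑ᵥ f (g , i) = ≤-trans (f≤sumFin 2 (λ j → f (g , j)) i) (f≤sumFin n (λ x → sumFin 2 (λ j → f (x , j))) g)

  ∑ᵥ-comm : ∀ (f : Vertex → Vertex → ℕ) → ∑ᵥ (λ u → ∑ᵥ (f u)) ≡ ∑ᵥ (λ v → ∑ᵥ (λ u → f u v))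
  ∑ᵥ-comm f = begin
    sumFin n (λ g → sumFin 2 (λ i → sumFin n (λ h → sumFin 2 (λ j → f (g , i) (h , j)))))
      ≡⟨ sumFin-cong n (λ g → trans (sumFin-comm 2 n (λ i h → sumFin 2 (λ j → f (g , i) (h , j))))
                                    (sumFin-cong n (λ h → sumFin-comm 2 2 (λ i j → f (g , i) (h , j))))) ⟩
    sumFin n (λ g → sumFin n (λ h → sumFin 2 (λ j → sumFin 2 (λ i → f (g , i) (h , j)))))
      ≡⟨ sumFin-comm n n (λ g h → sumFin 2 (λ j → sumFin 2 (λ i → f (g , i) (h , j)))) ⟩
    sumFin n (λ h → sumFin n (λ g → sumFin 2 (λ j → sumFin 2 (λ i → f (g , i) (h , j)))))
      ≡⟨ sumFin-cong n (λ h → sumFin-comm n 2 (λ g j → sumFin 2 (λ i → f (g , i) (h , j)))) ⟩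
    sumFin n (λ h → sumFin 2 (λ j → sumFin n (λ g → sumFin 2 (λ i → f (g , i) (h , j))))) ∎
    where open ≡-Reasoning

  ∑ᵥ-layers : ∀ i (f : Vertex → ℕ) → ∑ᵥ f ≡ layerSum f i + layerSum f (opposite i)
  ∑ᵥ-layers zero       f = trans (sumFin-cong n (λ g → cong (f (g , zero) +_) (+-identityʳ _)))
                                 (sumFin-+ n (λ g → f (g , zero)) (λ g → f (g , suc zero)))
  ∑ᵥ-layers (suc zero) f = trans (∑ᵥ-layers zero f) (+-comm (layerSum f zero) (layerSum f (suc zero)))

  layerSum≤∑ᵥ : ∀ i (f : Vertex → ℕ) → layerSum f i ≤ ∑ᵥ f
  layerSum≤∑ᵥ i f = ≤-trans (m≤m+n _ _) (≤-reflexive (sym (∑ᵥ-layers i f)))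

  arcsIn≡arcsOut-flip : ∀ R A → arcsIn R A ≡ arcsOut (flip R) A
  arcsIn≡arcsOut-flip R A =
    trans (∑ᵥ-comm (λ u v → [ not (A u) ∧ A v ∧ R u v ]))
          (∑ᵥ-cong λ v → ∑ᵥ-cong λ u → cong [_] (exchange (not (A u)) (A v) (R u v)))
    where
    exchange : ∀ x y z → x ∧ y ∧ z ≡ y ∧ x ∧ z
    exchange x y z = trans (sym (∧-assoc x y z)) (trans (cong (_∧ z) (∧-comm x y)) (∧-assoc y x z))

  BlockRegular : Digraph → (Fin 2 → Fin 2 → ℕ) → Set
  BlockRegular R c = ∀ i j → (∀ g → size (λ h → R (g , i) (h , j)) ≡ c i j)
                           × (∀ h → size (λ g → R (g , i) (h , j)) ≡ c i j)

  flip-regular : ∀ {R c} → BlockRegular R c → BlockRegular (flip R) (flip c)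
  flip-regular regular i j = swap (regular j i)

  arc⇒1≤c : ∀ {R c} → BlockRegular R c → ∀ {i j g h} → R (g , i) (h , j) ≡ true → 1 ≤ c i j
  arc⇒1≤c {R} regular {i} {j} {g} {h} r = begin
    1                               ≡⟨ cong [_] (sym r) ⟩
    [ R (g , i) (h , j) ]           ≤⟨ f≤sumFin n _ h ⟩
    size (λ y → R (g , i) (y , j))  ≡⟨ proj₁ (regular i j) g ⟩
    _                               ∎
    where open ≤-Reasoning

  module _ {R : Digraph} (loopless : ∀ u → R u u ≡ false) where

    small-set⇒d≤arcsOut : ∀ {d A u₀} → (∀ u → d ≤ outdegree R u) → A u₀ ≡ true → count A ≤ d →
      d ≤ arcsOut R A
    small-set⇒d≤arcsOut {d} {A} {u₀} outdegree≥d Au₀ m≤d = begin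
      d                                   ≤⟨ n≤m*[1+n∸m] 1≤m m≤d ⟩
      m * (suc d ∸ m)                     ≡⟨ sym (∑ᵥ-*ʳ (suc d ∸ m) (λ u → [ A u ])) ⟩
      ∑ᵥ (λ u → [ A u ] * (suc d ∸ m))    ≤⟨ ∑ᵥ-mono exits-bound ⟩
      ∑ᵥ (λ u → [ A u ] * exits u)        ≡⟨ sym (∑ᵥ-cong λ u → ∑ᵥ-[∧]ˡ (A u) (λ v → not (A v) ∧ R u v)) ⟩
      arcsOut R A                         ∎
      where
      open ≤-Reasoning
      m : ℕ
      m = count A
      exits entries : Vertex → ℕ
      exits   u = ∑ᵥ (λ v → [ not (A v) ∧ R u v ])
      entries u = ∑ᵥ (λ v → [ A v ∧ R u v ])

      1≤m : 1 ≤ m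
      1≤m = ≤-trans (≤-reflexive (cong [_] (sym Au₀))) (f≤∑ᵥ (λ v → [ A v ]) u₀)

      entries<m : ∀ u → A u ≡ true → suc (entries u) ≤ m
      entries<m u Au = begin
        suc (entries u)      ≡⟨ +-comm 1 (entries u) ⟩
        entries u + 1        ≤⟨ +-monoʳ-≤ (entries u) (≤-trans (≤-reflexive u-is-non-neighbour) (f≤∑ᵥ non-neighbours u)) ⟩
        entries u + ∑ᵥ non-neighbours
                             ≡⟨ cong (_+ ∑ᵥ non-neighbours) (∑ᵥ-cong λ v → cong [_] (∧-comm (A v) (R u v))) ⟩
        ∑ᵥ (λ v → [ R u v ∧ A v ]) + ∑ᵥ (λ v → [ not (R u v) ∧ A v ])
                             ≡⟨ sym (∑ᵥ-+ (λ v → [ R u v ∧ A v ]) (λ v → [ not (R u v) ∧ A v ])) ⟩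
        ∑ᵥ (λ v → [ R u v ∧ A v ] + [ not (R u v) ∧ A v ])
                             ≡⟨ sym (∑ᵥ-cong λ v → []-split (R u v) (A v)) ⟩
        m                    ∎
        where
        non-neighbours : Vertex → ℕ
        non-neighbours v = [ not (R u v) ∧ A v ]
        u-is-non-neighbour : 1 ≡ [ not (R u u) ∧ A u ]
        u-is-non-neighbour rewrite loopless u | Au = refl

      exits-bound : ∀ u → [ A u ] * (suc d ∸ m) ≤ [ A u ] * exits u
      exits-bound u with A u in Au
      ... | false = z≤n
      ... | true  = *-monoʳ-≤ 1 (m≤n+o⇒m∸n≤o (suc d) m (begin
        suc d                      ≤⟨ s≤s (outdegree≥d u) ⟩
        suc (outdegree R u)        ≡⟨ cong suc (trans (∑ᵥ-cong λ v → []-split (A v) (R u v))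
                                                      (∑ᵥ-+ (λ v → [ A v ∧ R u v ]) (λ v → [ not (A v) ∧ R u v ]))) ⟩
        suc (entries u) + exits u  ≤⟨ +-monoˡ-≤ (exits u) (entries<m u Au) ⟩
        m + exits u                ∎))

    module _ {c : Fin 2 → Fin 2 → ℕ} (regular : BlockRegular R c) where

      indegree-regular : ∀ g i → indegree R (g , i) ≡ c i i + c (opposite i) i
      indegree-regular g i = trans (∑ᵥ-layers i (λ u → [ R u (g , i) ]))
        (cong₂ _+_ (proj₂ (regular i i) g) (proj₂ (regular (opposite i) i) g))

      thin-layer⇒d≤arcsOut : ∀ {d A} i (g : Fin n) → (∀ v → d ≤ indegree R v) → 1 ≤ c (opposite i) i →
        2 ≤ d → layerCount A i ≤ 1 → d < count A → d ≤ arcsOut R A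
      thin-layer⇒d≤arcsOut {d} {A} i g indegree≥d t≥1 2≤d p≤1 d<m =
        thin-layer-arithmetic p≤1 (subst (d <_) (∑ᵥ-layers i (λ v → [ A v ])) d<m) 2≤d t≥1
          (subst (d ≤_) (indegree-regular g i) (indegree≥d (g , i))) counted
        where
        j : Fin 2
        j = opposite i
        P Q : Fin n → Bool
        P x = A (x , i)
        Q x = A (x , j)
        intoLayer : Vertex → ℕ
        intoLayer u = layerSum (λ v → [ A u ∧ not (A v) ∧ R u v ]) i

        counted : size P * c i i + size Q * c j i ≤ arcsOut R A + size P * c j i
        counted = begin
          size P * c i i + size Q * c j i
            ≤⟨ +-mono-≤ (≤-reflexive (sym (singleton-exits P (λ a x → R (a , i) (x , i)) p≤1
                                            (λ a → loopless (a , i)) (proj₁ (regular i i)))))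
                        (crossing-count P Q (λ u v → R (u , j) (v , i))
                                            (proj₁ (regular j i)) (proj₂ (regular j i))) ⟩
          layerSum intoLayer i + (layerSum intoLayer j + size P * c j i)
            ≡⟨ sym (+-assoc (layerSum intoLayer i) (layerSum intoLayer j) _) ⟩
          (layerSum intoLayer i + layerSum intoLayer j) + size P * c j i
            ≡⟨ cong (_+ size P * c j i) (sym (∑ᵥ-layers i intoLayer)) ⟩
          ∑ᵥ intoLayer + size P * c j i
            ≤⟨ +-monoˡ-≤ (size P * c j i) (∑ᵥ-mono λ u → layerSum≤∑ᵥ i (λ v → [ A u ∧ not (A v) ∧ R u v ])) ⟩
          arcsOut R A + size P * c j i ∎
          where open ≤-Reasoning

      thick-layers : ∀ {d A u₀} → (∀ v → d ≤ outdegree R v × d ≤ indegree R v) →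
        (∀ i → 1 ≤ c (opposite i) i) → A u₀ ≡ true → 1 ≤ arcsOut R A → arcsOut R A < d →
        ∀ i → 2 ≤ layerCount A i
      thick-layers {d} {A} {g , _} degree≥d cross Au₀ 1≤ω ω<d i with 2 ≤? layerCount A i
      ... | yes 2≤p = 2≤p
      ... | no  2≰p = contradiction d≤ω (<⇒≱ ω<d)
        where
        d≤ω : d ≤ arcsOut R A
        d≤ω with count A ≤? d
        ... | yes m≤d = small-set⇒d≤arcsOut {A = A} (proj₁ ∘ degree≥d) Au₀ m≤d
        ... | no  m≰d = thin-layer⇒d≤arcsOut {A = A} i g (proj₂ ∘ degree≥d) (cross i) (≤-trans (s≤s 1≤ω) ω<d)
                          (s≤s⁻¹ (≰⇒> 2≰p)) (≰⇒> m≰d)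

module CayleyArcs (G : FinGroup) (S₀ S₁ T₀ T₁ : Subset (FinGroup.n G)) where
  open FinGroup G
  open MixedCayley G S₀ S₁ T₀ T₁
  open TwoLayer n

  group : Group _ _
  group = record { _≈_ = _≡_ ; _∙_ = _∙_ ; ε = ε ; _⁻¹ = _⁻¹ ; isGroup = isGroup }

  open IsGroup isGroup using (inverseʳ)
  open GroupProperties group
    using (//-rightDividesˡ; //-rightDividesʳ; \\-leftDividesˡ; \\-leftDividesʳ; ⁻¹-involutive)

  sumFin-∙ʳ : ∀ a (f : Fin n → ℕ) → sumFin n (λ h → f (h ∙ a)) ≡ sumFin n f
  sumFin-∙ʳ a f = sumFin-reindex n f (_∙ a) (λ h → h ∙ (a ⁻¹)) (//-rightDividesˡ a) (//-rightDividesʳ a)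

  sumFin-∙ˡ : ∀ a (f : Fin n → ℕ) → sumFin n (λ h → f (a ∙ h)) ≡ sumFin n f
  sumFin-∙ˡ a f = sumFin-reindex n f (a ∙_) (λ h → (a ⁻¹) ∙ h) (\\-leftDividesˡ a) (\\-leftDividesʳ a)

  sumFin-⁻¹ : ∀ (f : Fin n → ℕ) → sumFin n (λ h → f (h ⁻¹)) ≡ sumFin n f
  sumFin-⁻¹ f = sumFin-reindex n f _⁻¹ _⁻¹ ⁻¹-involutive ⁻¹-involutive

  row-size : ∀ S g → size (λ h → lookup S (h ∙ (g ⁻¹))) ≡ size (lookup S)
  row-size S g = sumFin-∙ʳ (g ⁻¹) (λ z → [ lookup S z ])

  column-size : ∀ S h → size (λ g → lookup S (h ∙ (g ⁻¹))) ≡ size (lookup S)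
  column-size S h = trans (sumFin-⁻¹ (λ g → [ lookup S (h ∙ g) ])) (sumFin-∙ˡ h (λ z → [ lookup S z ]))

  degreeMatrix : Fin 2 → Fin 2 → ℕ
  degreeMatrix zero       zero       = size (lookup S₀)
  degreeMatrix zero       (suc zero) = size (lookup T₀)
  degreeMatrix (suc zero) zero       = size (lookup T₁)
  degreeMatrix (suc zero) (suc zero) = size (lookup S₁)

  arc-regular : BlockRegular arc degreeMatrix
  arc-regular zero       zero       = row-size S₀ , column-size S₀
  arc-regular zero       (suc zero) = row-size T₀ , column-size T₀
  arc-regular (suc zero) zero       = column-size T₁ , row-size T₁
  arc-regular (suc zero) (suc zero) = row-size S₁ , column-size S₁

  ∉⇒g∙g⁻¹∉ : ∀ {S} → ε ∉ S → ∀ g → lookup S (g ∙ (g ⁻¹)) ≡ false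
  ∉⇒g∙g⁻¹∉ {S} ε∉S g = trans (cong (lookup S) (inverseʳ g)) (¬-not (ε∉S ∘ lookup⇒[]= ε S))

  arc-loopless : ε ∉ S₀ → ε ∉ S₁ → ∀ u → arc u u ≡ false
  arc-loopless ε∉S₀ _    (g , zero)     = ∉⇒g∙g⁻¹∉ ε∉S₀ g
  arc-loopless _    ε∉S₁ (g , suc zero) = ∉⇒g∙g⁻¹∉ ε∉S₁ g

  crossing-arc : ∀ {R : ASet} i {g h} → Reach R (g , i) (h , opposite i) →
    ∃₂ λ x y → R (x , i) (y , opposite i) ≡ true
  crossing-arc zero       (step {w = _ , zero}     _ rest) = crossing-arc zero rest
  crossing-arc zero       (step {w = y , suc zero} r _)    = _ , y , r
  crossing-arc (suc zero) (step {w = _ , suc zero} _ rest) = crossing-arc (suc zero) rest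
  crossing-arc (suc zero) (step {w = y , zero}     r _)    = _ , y , r

  strongly-connected⇒1≤degreeMatrix : StronglyConnected arc → Fin n → ∀ i → 1 ≤ degreeMatrix i (opposite i)
  strongly-connected⇒1≤degreeMatrix sc g i with crossing-arc i (sc (g , i) (g , opposite i))
  ... | x , y , r = arc⇒1≤c arc-regular {i} {opposite i} {x} {y} r

  reach-mono : ∀ {R R′ : ASet} → (∀ u v → R u v ≡ true → R′ u v ≡ true) → ∀ {u v} → Reach R u v → Reach R′ u v
  reach-mono R⊆R′ here          = here
  reach-mono R⊆R′ (step r rest) = step (R⊆R′ _ _ r) (reach-mono R⊆R′ rest)

  strongly-connected⇒1≤λ : StronglyConnected arc → ∀ {l} → IsArcConnectivity l → 1 ≤ l
  strongly-connected⇒1≤λ sc {suc l} _ = s≤s z≤n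
  strongly-connected⇒1≤λ sc {zero} ((F , _ , ∣F∣≡0 , disconnected) , _) =
    contradiction (λ u v → reach-mono kept (sc u v)) disconnected
    where
    F-empty : ∀ u v → F u v ≡ false
    F-empty u v = ¬-not λ Fuv → 1+n≰n (begin
      1                          ≡⟨ cong [_] (sym Fuv) ⟩
      [ F u v ]                  ≤⟨ f≤∑ᵥ (λ w → [ F u w ]) v ⟩
      ∑ᵥ (λ w → [ F u w ])       ≤⟨ f≤∑ᵥ (λ x → ∑ᵥ (λ w → [ F x w ])) u ⟩
      ∣ F ∣ₐ                     ≡⟨ ∣F∣≡0 ⟩
      0                          ∎)
      where open ≤-Reasoning
    kept : ∀ u v → arc u v ≡ true → remove F u v ≡ true
    kept u v a = cong₂ (λ x y → x ∧ not y) a (F-empty u v)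

lemma3p2 : (G : FinGroup) (S₀ S₁ T₀ T₁ : Subset (FinGroup.n G)) →
    FinGroup.ε G ∉ S₀ → FinGroup.ε G ∉ S₁ →
    let open MixedCayley G S₀ S₁ T₀ T₁ in
    StronglyConnected arc →
    (l d : ℕ) → IsArcConnectivity l → IsMinDegree d →
    (A : VSet) → IsλAtom l A →
    l < d →
    2 ≤ ∣ A ∩X zero ∣ × 2 ≤ ∣ A ∩X suc zero ∣
lemma3p2 G S₀ S₁ T₀ T₁ ε∉S₀ ε∉S₁ sc l d connectivity (degree≥d , _) A ((((u₀ , Au₀) , _) , fragment) , _) l<d =
  thick fragment zero , thick fragment (suc zero)
  where
  open FinGroup G using (n)
  open MixedCayley G S₀ S₁ T₀ T₁
  open TwoLayer n
  open CayleyArcs G S₀ S₁ T₀ T₁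

  cross : ∀ i → 1 ≤ degreeMatrix i (opposite i)
  cross = strongly-connected⇒1≤degreeMatrix sc (proj₁ u₀)

  loopless : ∀ u → arc u u ≡ false
  loopless = arc-loopless ε∉S₀ ε∉S₁

  thick-if-boundary≡l : ∀ {R c} → (∀ u → R u u ≡ false) → BlockRegular R c →
    (∀ v → d ≤ outdegree R v × d ≤ indegree R v) → (∀ i → 1 ≤ c (opposite i) i) →
    arcsOut R A ≡ l → ∀ i → 2 ≤ layerCount A i
  thick-if-boundary≡l loopless′ regular degree≥d′ cross′ ω≡l =
    thick-layers loopless′ regular degree≥d′ cross′ Au₀
      (subst (1 ≤_) (sym ω≡l) (strongly-connected⇒1≤λ sc connectivity)) (subst (_< d) (sym ω≡l) l<d)

  thick : ∣ ω⁺ A ∣ₐ ≡ l ⊎ ∣ ω⁻ A ∣ₐ ≡ l → ∀ i → 2 ≤ layerCount A i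
  thick (inj₁ ω⁺≡l) = thick-if-boundary≡l loopless arc-regular degree≥d
    (λ i → subst (λ j → 1 ≤ degreeMatrix (opposite i) j) (opposite-involutive i) (cross (opposite i))) ω⁺≡l
  thick (inj₂ ω⁻≡l) = thick-if-boundary≡l {flip arc} loopless (flip-regular arc-regular) (swap ∘ degree≥d) cross
    (trans (sym (arcsIn≡arcsOut-flip arc A)) ω⁻≡l)
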